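{- Let $A$ be the adjacency matrix of a Paley type strongly regular graph with parameters $(v,k,\lambda,\lambda+1)$. Fix a row of $A$ and let $R$ denote its support. Let $\mathcal{B}=\{R\cap S\mid S\ (\neq R)\text{ is the support of a row of }A\}$, and let $\mathcal{B}_\infty$ be the collection consisting of all members of $\mathcal{B}$ of size $\lambda+1$, together with all members of $\mathcal{B}$ of size $\lambda$ each modified by adjoining a new point $\infty$. Let $\mathcal{B}_{\overline{\infty}}$ be the collection of complements in $R\cup\{\infty\}$ of the members of $\mathcal{B}_\infty$. Then $(R\cup\{\infty\},\mathcal{B}_{\overline{\infty}})$ is a $2$-$(k+1,\lambda+2,\lambda+1)$ adesign.
   Context: A strongly regular graph with parameters $(v,k,\lambda,\mu)$ is a graph on $v$ vertices, regular of degree $k$, in which any two adjacent vertices have exactly $\lambda$ common neighbours and any two distinct non-adjacent vertices have exactly $\mu$ common neighbours. It is of Paley type if, up to complementation, its parameters are $(v,\frac{v-1}{2},\frac{v-5}{4},\frac{v-1}{4})$. A $2$-$(v,k,\lambda)$ adesign is an incidence structure with $v$ points and all blocks of size $k$, in which every pair of distinct points lies in either $\lambda$ or $\lambda+1$ blocks for a positive integer $\lambda$, and which is not a $2$-design. -}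

module Defs where

open import Data.Nat using (ℕ; zero; suc; _+_; _*_; _∸_; _≡ᵇ_; _≤_)
open import Data.Bool using (Bool; true; false; _∧_; not; _xor_; if_then_else_)
open import Data.Fin using (Fin)
open import Data.Maybe using (Maybe; nothing; just)
open import Data.List using (List; []; _∷_; [_]; length; map; concatMap; allFin; filterᵇ)
open import Data.Bool.ListAction using (any)
open import Data.List.Relation.Unary.All using (All)
open import Data.List.Relation.Unary.Unique.Propositional using (Unique)
open import Data.List.Membership.Propositional using (_∈_)
open import Data.Product using (_×_; ∃)
open import Data.Sum using (_⊎_)
open import Relation.Nullary using (¬_)
open import Relation.Binary.PropositionalEquality using (_≡_; _≢_)

countᵇ : {X : Set} → (X → Bool) → List X → ℕ
countᵇ p []       = 0
countᵇ p (x ∷ xs) = if p x then suc (countᵇ p xs) else countᵇ p xs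

degree : {v : ℕ} → (Fin v → Fin v → Bool) → Fin v → ℕ
degree {v} A x = countᵇ (A x) (allFin v)

common : {v : ℕ} → (Fin v → Fin v → Bool) → Fin v → Fin v → ℕ
common {v} A x y = countᵇ (λ z → A x z ∧ A y z) (allFin v)

IsSRG : (v k l m : ℕ) → (Fin v → Fin v → Bool) → Set
IsSRG v k l m A =
  (∀ x y → A x y ≡ A y x) ×
  (∀ x → A x x ≡ false) ×
  (∀ x → degree A x ≡ k) ×
  (∀ x y → x ≢ y → A x y ≡ true → common A x y ≡ l) ×
  (∀ x y → x ≢ y → A x y ≡ false → common A x y ≡ m)

-- (v,k,l,m) = (v, (v-1)/2, (v-5)/4, (v-1)/4), written without division
PaleyParams : (v k l m : ℕ) → Set
PaleyParams v k l m = (2 * k + 1 ≡ v) × (4 * l + 5 ≡ v) × (4 * m + 1 ≡ v)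

-- Paley type: up to complementation the parameters are the Paley ones.
-- Complement of an SRG(v,k,l,m) has parameters (v, v-k-1, v-2-2k+m, v-2k+l).
IsPaleyType : (v k l m : ℕ) → Set
IsPaleyType v k l m =
  PaleyParams v k l m ⊎
  PaleyParams v (v ∸ k ∸ 1) ((v + m) ∸ (2 + 2 * k)) ((v + l) ∸ (2 * k))

-- Incidence structures: points form a duplicate-free list, blocks form a
-- list (repetitions allowed) of subsets of the points, given as boolean
-- predicates on the ambient type X.

pairCount : {X : Set} → List (X → Bool) → X → X → ℕ
pairCount blocks x y = countᵇ (λ B → B x ∧ B y) blocks

IsAdesign : {X : Set} → List X → List (X → Bool) → (n kk lam : ℕ) → Set
IsAdesign {X} pts blocks n kk lam =
  Unique pts ×
  length pts ≡ n ×
  All (λ B → ∀ x → B x ≡ true → x ∈ pts) blocks ×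
  All (λ B → countᵇ B pts ≡ kk) blocks ×
  1 ≤ lam ×
  (∀ x y → x ∈ pts → y ∈ pts → x ≢ y →
     (pairCount blocks x y ≡ lam) ⊎ (pairCount blocks x y ≡ suc lam)) ×
  ¬ (∃ λ c → ∀ x y → x ∈ pts → y ∈ pts → x ≢ y → pairCount blocks x y ≡ c)

-- The construction.  Points of Maybe (Fin v): nothing = ∞, just z = z.

pointsR∞ : {v : ℕ} → (Fin v → Fin v → Bool) → Fin v → List (Maybe (Fin v))
pointsR∞ {v} A r = nothing ∷ map just (filterᵇ (A r) (allFin v))

inR∞ : {v : ℕ} → (Fin v → Fin v → Bool) → Fin v → Maybe (Fin v) → Bool
inR∞ A r nothing  = true
inR∞ A r (just z) = A r z

otherRows : {v : ℕ} → (Fin v → Fin v → Bool) → Fin v → List (Fin v)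
otherRows {v} A r = filterᵇ (λ s → any (λ z → A r z xor A s z) (allFin v)) (allFin v)

blocksB : {v : ℕ} → (Fin v → Fin v → Bool) → Fin v → List (Fin v → Bool)
blocksB A r = map (λ s z → A r z ∧ A s z) (otherRows A r)

extend : {v : ℕ} → (Fin v → Bool) → Bool → Maybe (Fin v) → Bool
extend b e nothing  = e
extend b e (just z) = b z

toInf : {v : ℕ} → ℕ → (Fin v → Bool) → List (Maybe (Fin v) → Bool)
toInf {v} l b =
  if countᵇ b (allFin v) ≡ᵇ suc l then [ extend b false ]
  else if countᵇ b (allFin v) ≡ᵇ l then [ extend b true ]
  else []

blocksB∞ : {v : ℕ} → (Fin v → Fin v → Bool) → ℕ → Fin v → List (Maybe (Fin v) → Bool)
blocksB∞ A l r = concatMap (toInf l) (blocksB A r)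

blocksB∞̄ : {v : ℕ} → (Fin v → Fin v → Bool) → ℕ → Fin v → List (Maybe (Fin v) → Bool)
blocksB∞̄ A l r = map (λ B x → inR∞ A r x ∧ not (B x)) (blocksB∞ A l r)

module Submission where

-- Identify ∞ with the vertex r. For every other vertex s, the block of 𝓑_∞̄ coming from s
-- is then exactly the set of points of R ∪ {∞} not adjacent to s (the size of R ∩ S,
-- λ or λ+1, decides whether ∞ is put in). So the pair count of two points with
-- distinct vertices a, b is the number of vertices adjacent to neither, which by
-- inclusion–exclusion is v − 2k + |N(a) ∩ N(b)| = 1 + λ or 1 + (λ+1) since v = 2k + 1.
-- Each block has k − |R ∩ S| points of R, plus ∞ when |R ∩ S| = λ+1, hence λ+2 points.
-- Both pair counts occur: ∞ with a neighbour of r, and two non-adjacent neighbours of r.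

open import Defs
open import Data.Nat using (ℕ; zero; suc; _+_; _*_; _∸_; _≡ᵇ_; _<_; z≤n; s≤s)
open import Data.Nat.Properties
open import Data.Nat.Tactic.RingSolver using (solve-∀)
open import Data.Bool using (Bool; true; false; _∧_; _∨_; not; _xor_; T)
open import Data.Bool.Properties using (∧-zeroʳ; ∧-conicalˡ; ∧-conicalʳ; not-injective; ¬-not; xor-same; T-≡)
open import Data.Bool.ListAction using (any)
open import Data.Fin using (Fin)
open import Data.Fin.Properties using () renaming (_≟_ to _≟ᶠ_)
open import Data.Maybe using (Maybe; nothing; just)
open import Data.Maybe.Properties using (just-injective)
open import Data.List using (List; []; _∷_; [_]; length; map; concatMap; allFin; filterᵇ)
open import Data.List.Properties using (length-map; length-tabulate; concatMap-map; map-∘)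
open import Data.List.Relation.Unary.All as All using (All; []; _∷_; universal)
import Data.List.Relation.Unary.All.Properties as All
open import Data.List.Relation.Unary.Any using (here; there)
open import Data.List.Relation.Unary.Unique.Propositional using (Unique; _∷_)
import Data.List.Relation.Unary.Unique.Propositional.Properties as Unique
open import Data.List.Membership.Propositional using (_∈_)
open import Data.List.Membership.Propositional.Properties using (∈-allFin; ∈-map⁻; ∈-map⁺; ∈-filter⁻; ∈-filter⁺)
open import Data.Product using (_×_; _,_; proj₂; ∃)
open import Data.Sum using (_⊎_; inj₁; inj₂)
import Data.Sum as Sum
open import Function using (_∘_; Equivalence)
open import Relation.Nullary using (¬_; yes; no; contradiction)
open import Relation.Nullary.Decidable using (T?)
open import Relation.Binary.Definitions using (DecidableEquality)
open import Relation.Binary.PropositionalEquality hiding ([_])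

private
  variable
    X Y : Set

countᵇ-cong : {p q : X → Bool} → p ≗ q → ∀ xs → countᵇ p xs ≡ countᵇ q xs
countᵇ-cong p≗q [] = refl
countᵇ-cong {q = q} p≗q (x ∷ xs) rewrite p≗q x with q x
... | true  = cong suc (countᵇ-cong p≗q xs)
... | false = countᵇ-cong p≗q xs

countᵇ-map : ∀ (p : Y → Bool) (f : X → Y) xs → countᵇ p (map f xs) ≡ countᵇ (p ∘ f) xs
countᵇ-map p f [] = refl
countᵇ-map p f (x ∷ xs) with p (f x)
... | true  = cong suc (countᵇ-map p f xs)
... | false = countᵇ-map p f xs

countᵇ-filterᵇ : ∀ (p q : X → Bool) xs →
                 countᵇ p (filterᵇ q xs) ≡ countᵇ (λ x → q x ∧ p x) xs
countᵇ-filterᵇ p q [] = refl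
countᵇ-filterᵇ p q (x ∷ xs) with q x
... | false = countᵇ-filterᵇ p q xs
... | true with p x
...   | true  = cong suc (countᵇ-filterᵇ p q xs)
...   | false = countᵇ-filterᵇ p q xs

length-filterᵇ : ∀ (p : X → Bool) xs → length (filterᵇ p xs) ≡ countᵇ p xs
length-filterᵇ p [] = refl
length-filterᵇ p (x ∷ xs) with p x
... | true  = cong suc (length-filterᵇ p xs)
... | false = length-filterᵇ p xs

countᵇ-split : ∀ (p q : X → Bool) xs →
  countᵇ p xs ≡ countᵇ (λ x → p x ∧ q x) xs + countᵇ (λ x → p x ∧ not (q x)) xs
countᵇ-split p q [] = refl
countᵇ-split p q (x ∷ xs) with p x | q x
... | true  | true  = cong suc (countᵇ-split p q xs)
... | true  | false = trans (cong suc (countᵇ-split p q xs)) (sym (+-suc _ _))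
... | false | _     = countᵇ-split p q xs

countᵇ-not : ∀ (p : X → Bool) xs → countᵇ (not ∘ p) xs + countᵇ p xs ≡ length xs
countᵇ-not p [] = refl
countᵇ-not p (x ∷ xs) with p x
... | true  = trans (+-suc _ _) (cong suc (countᵇ-not p xs))
... | false = cong suc (countᵇ-not p xs)

countᵇ-∨-∧ : ∀ (p q : X → Bool) xs →
  countᵇ p xs + countᵇ q xs ≡ countᵇ (λ x → p x ∨ q x) xs + countᵇ (λ x → p x ∧ q x) xs
countᵇ-∨-∧ p q [] = refl
countᵇ-∨-∧ p q (x ∷ xs) with p x | q x
... | true  | true  = cong suc (trans (+-suc _ _) (trans (cong suc (countᵇ-∨-∧ p q xs)) (sym (+-suc _ _))))
... | true  | false = cong suc (countᵇ-∨-∧ p q xs)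
... | false | true  = trans (+-suc _ _) (cong suc (countᵇ-∨-∧ p q xs))
... | false | false = countᵇ-∨-∧ p q xs

not-∨ : ∀ a b → not (a ∨ b) ≡ not a ∧ not b
not-∨ true  b = refl
not-∨ false b = refl

countᵇ-inclusion-exclusion : ∀ (p q : X → Bool) xs →
  countᵇ (λ x → not (p x) ∧ not (q x)) xs + (countᵇ p xs + countᵇ q xs)
    ≡ length xs + countᵇ (λ x → p x ∧ q x) xs
countᵇ-inclusion-exclusion p q xs = begin
  countᵇ (λ x → not (p x) ∧ not (q x)) xs + (countᵇ p xs + countᵇ q xs)
    ≡⟨ cong₂ _+_ (countᵇ-cong (λ x → sym (not-∨ (p x) (q x))) xs) (countᵇ-∨-∧ p q xs) ⟩
  neither + (either + both)  ≡⟨ sym (+-assoc neither either both) ⟩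
  neither + either + both    ≡⟨ cong (_+ both) (countᵇ-not (λ x → p x ∨ q x) xs) ⟩
  length xs + both           ∎
  where
  open ≡-Reasoning
  neither either both : ℕ
  neither = countᵇ (λ x → not (p x ∨ q x)) xs
  either  = countᵇ (λ x → p x ∨ q x) xs
  both    = countᵇ (λ x → p x ∧ q x) xs

countᵇ-pos⇒∃ : ∀ (p : X → Bool) xs → 0 < countᵇ p xs → ∃ λ x → x ∈ xs × p x ≡ true
countᵇ-pos⇒∃ p (x ∷ xs) pos with p x in px
... | true  = x , here refl , px
... | false with countᵇ-pos⇒∃ p xs pos
...   | y , y∈xs , py = y , there y∈xs , py

countᵇ>1⇒∃≢ : DecidableEquality X → ∀ (p : X → Bool) {xs} → Unique xs → 1 < countᵇ p xs →
              ∀ a → ∃ λ x → x ∈ xs × p x ≡ true × x ≢ a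
countᵇ>1⇒∃≢ _≟_ p {x ∷ xs} (x∉xs ∷ xs!) >1 a with p x in px
... | false with countᵇ>1⇒∃≢ _≟_ p xs! >1 a
...   | y , y∈xs , py , y≢a = y , there y∈xs , py , y≢a
countᵇ>1⇒∃≢ _≟_ p {x ∷ xs} (x∉xs ∷ xs!) (s≤s pos) a | true with x ≟ a | countᵇ-pos⇒∃ p xs pos
... | no x≢a   | _              = x , here refl , px , x≢a
... | yes refl | y , y∈xs , py = y , there y∈xs , py , λ { refl → All.lookup x∉xs y∈xs refl }

any-false : ∀ (p : X → Bool) xs → (∀ x → p x ≡ false) → any p xs ≡ false
any-false p [] _ = refl
any-false p (x ∷ xs) p≡false rewrite p≡false x = any-false p xs p≡false

any-false⁻ : ∀ (p : X → Bool) {x} xs → any p xs ≡ false → x ∈ xs → p x ≡ false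
any-false⁻ p (y ∷ ys) none x∈ with p y in py
any-false⁻ p (y ∷ ys) () x∈ | true
any-false⁻ p (y ∷ ys) none (here refl)  | false = py
any-false⁻ p (y ∷ ys) none (there x∈ys) | false = any-false⁻ p ys none x∈ys

concatMap-singletons : {f : X → List Y} {g : X → Y} {xs : List X} →
                       All (λ x → f x ≡ [ g x ]) xs → concatMap f xs ≡ map g xs
concatMap-singletons []            = refl
concatMap-singletons (fx≡ ∷ rest) rewrite fx≡ = cong (_ ∷_) (concatMap-singletons rest)

≡ᵇ-refl : ∀ n → (n ≡ᵇ n) ≡ true
≡ᵇ-refl n = Equivalence.to T-≡ (≡⇒≡ᵇ n n refl)

≢⇒≡ᵇ-false : ∀ {m n} → m ≢ n → (m ≡ᵇ n) ≡ false
≢⇒≡ᵇ-false {m} {n} m≢n = ¬-not (m≢n ∘ ≡ᵇ⇒≡ m n ∘ Equivalence.from T-≡)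

toInf-suc : ∀ {v} l (b : Fin v → Bool) → countᵇ b (allFin v) ≡ suc l →
            toInf l b ≡ [ extend b false ]
toInf-suc l b size rewrite size | ≡ᵇ-refl l = refl

toInf-≡ : ∀ {v} l (b : Fin v → Bool) → countᵇ b (allFin v) ≡ l →
          toInf l b ≡ [ extend b true ]
toInf-≡ l b size rewrite size | ≢⇒≡ᵇ-false {l} {suc l} (1+n≢n ∘ sym) | ≡ᵇ-refl l = refl

adjacent⇒≢ : ∀ {v} {A : Fin v → Fin v → Bool} → (∀ x → A x x ≡ false) →
             ∀ {x y} → A x y ≡ true → x ≢ y
adjacent⇒≢ irrefl {x} Axy refl with () ← trans (sym Axy) (irrefl x)

degree-split : ∀ {v} (A : Fin v → Fin v → Bool) r s →
  degree A r ≡ common A r s + countᵇ (λ z → A r z ∧ not (A s z)) (allFin v)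
degree-split {v} A r s = countᵇ-split (A r) (A s) (allFin v)

nonadjacent-count : ∀ {v k} (A : Fin v → Fin v → Bool) a b → degree A a ≡ k → degree A b ≡ k →
  countᵇ (λ z → not (A a z) ∧ not (A b z)) (allFin v) + (k + k) ≡ v + common A a b
nonadjacent-count {v} {k} A a b deg-a deg-b = begin
  neither + (k + k)                    ≡⟨ cong (neither +_) (cong₂ _+_ (sym deg-a) (sym deg-b)) ⟩
  neither + (degree A a + degree A b)  ≡⟨ countᵇ-inclusion-exclusion (A a) (A b) (allFin v) ⟩
  length (allFin v) + common A a b     ≡⟨ cong (_+ common A a b) (length-tabulate (λ z → z)) ⟩
  v + common A a b                     ∎
  where
  open ≡-Reasoning
  neither : ℕ
  neither = countᵇ (λ z → not (A a z) ∧ not (A b z)) (allFin v)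

2*n+1≡1+[n+n] : ∀ n → 2 * n + 1 ≡ suc (n + n)
2*n+1≡1+[n+n] = solve-∀

4*n+5≡2*[2+2n]+1 : ∀ n → 4 * n + 5 ≡ 2 * (suc n + suc n) + 1
4*n+5≡2*[2+2n]+1 = solve-∀

paley-arithmetic : ∀ {v k l} → 2 * k + 1 ≡ v → 4 * l + 5 ≡ v → k ≡ suc l + suc l × v ≡ suc (k + k)
paley-arithmetic {v} {k} {l} 2k+1≡v 4l+5≡v = k≡ , v≡
  where
  v≡ : v ≡ suc (k + k)
  v≡ = trans (sym 2k+1≡v) (2*n+1≡1+[n+n] k)
  k≡ : k ≡ suc l + suc l
  k≡ = *-cancelˡ-≡ k (suc l + suc l) 2 (+-cancelʳ-≡ 1 (2 * k) (2 * (suc l + suc l))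
         (trans 2k+1≡v (trans (sym 4l+5≡v) (4*n+5≡2*[2+2n]+1 l))))

m∸n∸1≡1+w⇒m≡2+w+n : ∀ m n {w} → m ∸ n ∸ 1 ≡ suc w → m ≡ suc (suc w) + n
m∸n∸1≡1+w⇒m≡2+w+n zero    zero    ()
m∸n∸1≡1+w⇒m≡2+w+n zero    (suc n) ()
m∸n∸1≡1+w⇒m≡2+w+n (suc m) zero    m≡1+w = cong suc (trans m≡1+w (sym (+-identityʳ _)))
m∸n∸1≡1+w⇒m≡2+w+n (suc m) (suc n) eq    =
  trans (cong suc (m∸n∸1≡1+w⇒m≡2+w+n m n eq)) (sym (+-suc _ n))

-- In the complementary case the degree v − k − 1 of the complement turns out to be k itself.
isPaleyType⇒ : ∀ {v k l} → IsPaleyType v k l (suc l) → k ≡ suc l + suc l × v ≡ suc (k + k)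
isPaleyType⇒ (inj₁ (2k+1≡v , 4l+5≡v , _)) = paley-arithmetic 2k+1≡v 4l+5≡v
isPaleyType⇒ {v} {k} {l} (inj₂ (2k̄+1≡v , 4l̄+5≡v , _)) with paley-arithmetic 2k̄+1≡v 4l̄+5≡v
... | k̄≡ , v≡ = k≡ , v≡1+2k
  where
  k̄ l̄ : ℕ
  k̄ = v ∸ k ∸ 1
  l̄ = (v + suc l) ∸ (2 + 2 * k)
  k≡k̄ : k ≡ k̄
  k≡k̄ = trans (+-cancelˡ-≡ (suc (suc (l̄ + suc l̄))) k (suc l̄ + suc l̄)
                 (trans (sym (m∸n∸1≡1+w⇒m≡2+w+n v k k̄≡))
                        (trans v≡ (cong (λ t → suc (t + t)) k̄≡))))
               (sym k̄≡)
  v≡1+2k : v ≡ suc (k + k)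
  v≡1+2k = subst (λ t → v ≡ suc (t + t)) (sym k≡k̄) v≡
  l̄≡l : l̄ ≡ l
  l̄≡l = begin
    (v + suc l) ∸ (2 + 2 * k)                ≡⟨ cong (λ t → (t + suc l) ∸ (2 + 2 * k)) v≡1+2k ⟩
    (suc (k + k) + suc l) ∸ (2 + 2 * k)      ≡⟨ cong (λ t → (k + k + suc l) ∸ suc (k + t)) (+-identityʳ k) ⟩
    (k + k + suc l) ∸ suc (k + k)            ≡⟨ cong (_∸ suc (k + k)) (+-suc (k + k) l) ⟩
    (k + k + l) ∸ (k + k)                    ≡⟨ m+n∸m≡n (k + k) l ⟩
    l                                        ∎
    where open ≡-Reasoning
  k≡ : k ≡ suc l + suc l
  k≡ = trans k≡k̄ (trans k̄≡ (cong (λ t → suc t + suc t) l̄≡l))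

∧-absorbs : ∀ a b → a ∧ (a ∧ not (a ∧ b)) ≡ a ∧ not b
∧-absorbs true  b = refl
∧-absorbs false b = refl

xor≡false⇒∧≡ : ∀ a b → a xor b ≡ false → a ∧ b ≡ a
xor≡false⇒∧≡ true  true  _ = refl
xor≡false⇒∧≡ false b     _ = refl

module DerivedAdesign
  {v k l : ℕ} (A : Fin v → Fin v → Bool) (r : Fin v)
  (A-sym : ∀ x y → A x y ≡ A y x) (A-irrefl : ∀ x → A x x ≡ false)
  (regular : ∀ x → degree A x ≡ k)
  (common-adj : ∀ x y → x ≢ y → A x y ≡ true → common A x y ≡ l)
  (common-nonadj : ∀ x y → x ≢ y → A x y ≡ false → common A x y ≡ suc l)
  (k≡ : k ≡ suc l + suc l) (v≡ : v ≡ suc (k + k))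
  where

  R∞ : List (Maybe (Fin v))
  R∞ = pointsR∞ A r

  vertex : Maybe (Fin v) → Fin v
  vertex nothing  = r
  vertex (just z) = z

  meet : Fin v → Fin v → Bool
  meet s z = A r z ∧ A s z

  differs : Fin v → Bool
  differs s = any (λ z → A r z xor A s z) (allFin v)

  block : Fin v → Maybe (Fin v) → Bool
  block s x = inR∞ A r x ∧ not (extend (meet s) (A r s) x)

  sizeR∖S : Fin v → ℕ
  sizeR∖S s = countᵇ (λ z → A r z ∧ not (A s z)) (allFin v)

  common+sizeR∖S≡k : ∀ s → common A r s + sizeR∖S s ≡ suc l + suc l
  common+sizeR∖S≡k s = trans (sym (degree-split A r s)) (trans (regular r) k≡)

  sizeR∖S-adj : ∀ {s} → A r s ≡ true → sizeR∖S s ≡ suc (suc l)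
  sizeR∖S-adj {s} Ars = +-cancelˡ-≡ l (sizeR∖S s) (suc (suc l))
    (trans (cong (_+ sizeR∖S s) (sym (common-adj r s (adjacent⇒≢ A-irrefl Ars) Ars)))
           (trans (common+sizeR∖S≡k s) (sym (+-suc l (suc l)))))

  sizeR∖S-nonadj : ∀ {s} → s ≢ r → A r s ≡ false → sizeR∖S s ≡ suc l
  sizeR∖S-nonadj {s} s≢r Ars = +-cancelˡ-≡ (suc l) (sizeR∖S s) (suc l)
    (trans (cong (_+ sizeR∖S s) (sym (common-nonadj r s (s≢r ∘ sym) Ars))) (common+sizeR∖S≡k s))

  common-values : ∀ {a b} → a ≢ b → common A a b ≡ l ⊎ common A a b ≡ suc l
  common-values {a} {b} a≢b with A a b in adj
  ... | true  = inj₁ (common-adj a b a≢b adj)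
  ... | false = inj₂ (common-nonadj a b a≢b adj)

  common<k : ∀ {a b} → a ≢ b → common A a b < suc l + suc l
  common<k a≢b with common-values a≢b
  ... | inj₁ ≡l  = subst (_< suc l + suc l) (sym ≡l) (<-trans (n<1+n l) (m<m+n (suc l) (s≤s z≤n)))
  ... | inj₂ ≡1+l = subst (_< suc l + suc l) (sym ≡1+l) (m<m+n (suc l) (s≤s z≤n))

  distinct-rows-differ : ∀ {s} → s ≢ r → differs s ≡ true
  distinct-rows-differ {s} s≢r with differs s in rows-agree
  ... | true  = refl
  ... | false = contradiction (common<k (s≢r ∘ sym)) (<-irrefl common≡k)
    where
    common≡k : common A r s ≡ suc l + suc l
    common≡k = trans (countᵇ-cong (λ z → xor≡false⇒∧≡ (A r z) (A s z)
                                    (any-false⁻ _ (allFin v) rows-agree (∈-allFin z))) (allFin v))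
                     (trans (regular r) k≡)

  differs-r : differs r ≡ false
  differs-r = any-false _ (allFin v) (λ z → xor-same (A r z))

  ∈otherRows⇒≢ : ∀ {s} → s ∈ otherRows A r → s ≢ r
  ∈otherRows⇒≢ s∈ refl = subst T differs-r (proj₂ (∈-filter⁻ (T? ∘ differs) {xs = allFin v} s∈))

  toInf-meet : ∀ {s} → s ≢ r → toInf l (meet s) ≡ [ extend (meet s) (A r s) ]
  toInf-meet {s} s≢r with A r s in Ars
  ... | true  = toInf-≡ l (meet s) (common-adj r s (s≢r ∘ sym) Ars)
  ... | false = toInf-suc l (meet s) (common-nonadj r s (s≢r ∘ sym) Ars)

  blocksB∞̄≡ : blocksB∞̄ A l r ≡ map block (otherRows A r)
  blocksB∞̄≡ = begin
    map complement (concatMap (toInf l) (map meet (otherRows A r)))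
      ≡⟨ cong (map complement) (concatMap-map (toInf l) meet (otherRows A r)) ⟩
    map complement (concatMap (toInf l ∘ meet) (otherRows A r))
      ≡⟨ cong (map complement) (concatMap-singletons (All.tabulate (toInf-meet ∘ ∈otherRows⇒≢))) ⟩
    map complement (map (λ s → extend (meet s) (A r s)) (otherRows A r))
      ≡⟨ sym (map-∘ (otherRows A r)) ⟩
    map block (otherRows A r) ∎
    where
    open ≡-Reasoning
    complement : (Maybe (Fin v) → Bool) → Maybe (Fin v) → Bool
    complement B x = inR∞ A r x ∧ not (B x)

  block-vertex : ∀ {x} s → inR∞ A r x ≡ true → block s x ≡ not (A (vertex x) s)
  block-vertex {nothing} s _   = refl
  block-vertex {just z}  s Arz rewrite Arz = cong not (A-sym s z)

  ∈R∞⇒inR∞ : ∀ {x} → x ∈ R∞ → inR∞ A r x ≡ true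
  ∈R∞⇒inR∞ (here refl) = refl
  ∈R∞⇒inR∞ (there x∈) with ∈-map⁻ just x∈
  ... | z , z∈ , refl = Equivalence.to T-≡ (proj₂ (∈-filter⁻ (T? ∘ A r) {xs = allFin v} z∈))

  inR∞⇒∈R∞ : ∀ {x} → inR∞ A r x ≡ true → x ∈ R∞
  inR∞⇒∈R∞ {nothing} _   = here refl
  inR∞⇒∈R∞ {just z}  Arz =
    there (∈-map⁺ just (∈-filter⁺ (T? ∘ A r) (∈-allFin z) (Equivalence.from T-≡ Arz)))

  R∞-unique : Unique R∞
  R∞-unique = All.map⁺ (universal (λ _ ()) _)
            ∷ Unique.map⁺ just-injective (Unique.filter⁺ (T? ∘ A r) (Unique.allFin⁺ v))

  R∞-length : length R∞ ≡ suc k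
  R∞-length = cong suc (trans (length-map just (filterᵇ (A r) (allFin v)))
                              (trans (length-filterᵇ (A r) (allFin v)) (regular r)))

  vertex-adj-r : ∀ {x} → inR∞ A r x ≡ true → x ≢ nothing → A (vertex x) r ≡ true
  vertex-adj-r {nothing} _   ∞≢∞ = contradiction refl ∞≢∞
  vertex-adj-r {just z}  Arz _   = trans (A-sym z r) Arz

  vertex-injective : ∀ {x y} → inR∞ A r x ≡ true → inR∞ A r y ≡ true → x ≢ y → vertex x ≢ vertex y
  vertex-injective {nothing} {nothing} _   _   x≢y = contradiction refl x≢y
  vertex-injective {nothing} {just z}  _   Arz _   = adjacent⇒≢ A-irrefl Arz
  vertex-injective {just z}  {nothing} Arz _   _   = adjacent⇒≢ A-irrefl Arz ∘ sym
  vertex-injective {just a}  {just b}  _   _   x≢y = x≢y ∘ cong just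

  r-adjacent-to-one : ∀ {x y} → inR∞ A r x ≡ true → inR∞ A r y ≡ true → x ≢ y →
                      not (A (vertex x) r) ∧ not (A (vertex y) r) ≡ false
  r-adjacent-to-one {nothing} {y}      _   y∈ x≢y rewrite vertex-adj-r y∈ (x≢y ∘ sym) = ∧-zeroʳ _
  r-adjacent-to-one {just z}  {y}      Arz _  _   rewrite trans (A-sym z r) Arz = refl

  -- The block of s ≠ r is { x ∈ R ∪ {∞} | vertex x ≁ s }, and row r contributes no block.
  pair-indicator : ∀ {x y} → inR∞ A r x ≡ true → inR∞ A r y ≡ true → x ≢ y → ∀ s →
    differs s ∧ (block s x ∧ block s y) ≡ not (A (vertex x) s) ∧ not (A (vertex y) s)
  pair-indicator {x} {y} x∈ y∈ x≢y s with s ≟ᶠ r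
  ... | yes refl rewrite differs-r = sym (r-adjacent-to-one x∈ y∈ x≢y)
  ... | no s≢r   rewrite distinct-rows-differ s≢r =
    cong₂ _∧_ (block-vertex {x} s x∈) (block-vertex {y} s y∈)

  pairCount≡ : ∀ {x y} → x ∈ R∞ → y ∈ R∞ → x ≢ y →
               pairCount (blocksB∞̄ A l r) x y ≡ suc (common A (vertex x) (vertex y))
  pairCount≡ {x} {y} x∈ y∈ x≢y = +-cancelʳ-≡ (k + k) _ _ (begin
    pairCount (blocksB∞̄ A l r) x y + (k + k)
      ≡⟨ cong (λ bs → pairCount bs x y + (k + k)) blocksB∞̄≡ ⟩
    countᵇ (λ B → B x ∧ B y) (map block (otherRows A r)) + (k + k)
      ≡⟨ cong (_+ (k + k)) (countᵇ-map _ block (otherRows A r)) ⟩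
    countᵇ (λ s → block s x ∧ block s y) (otherRows A r) + (k + k)
      ≡⟨ cong (_+ (k + k)) (countᵇ-filterᵇ _ differs (allFin v)) ⟩
    countᵇ (λ s → differs s ∧ (block s x ∧ block s y)) (allFin v) + (k + k)
      ≡⟨ cong (_+ (k + k)) (countᵇ-cong (pair-indicator {x} {y} (∈R∞⇒inR∞ x∈) (∈R∞⇒inR∞ y∈) x≢y)
                                        (allFin v)) ⟩
    countᵇ (λ s → not (A a s) ∧ not (A b s)) (allFin v) + (k + k)
      ≡⟨ nonadjacent-count A a b (regular a) (regular b) ⟩
    v + common A a b
      ≡⟨ cong (_+ common A a b) v≡ ⟩
    suc (k + k + common A a b)
      ≡⟨ cong suc (+-comm (k + k) (common A a b)) ⟩
    suc (common A a b) + (k + k) ∎)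
    where
    open ≡-Reasoning
    a b : Fin v
    a = vertex x
    b = vertex y

  pairCount-values : ∀ x y → x ∈ R∞ → y ∈ R∞ → x ≢ y →
    pairCount (blocksB∞̄ A l r) x y ≡ suc l ⊎ pairCount (blocksB∞̄ A l r) x y ≡ suc (suc l)
  pairCount-values _ _ x∈ y∈ x≢y =
    Sum.map through-common through-common
            (common-values (vertex-injective (∈R∞⇒inR∞ x∈) (∈R∞⇒inR∞ y∈) x≢y))
    where
    through-common : ∀ {n} → common A _ _ ≡ n → pairCount (blocksB∞̄ A l r) _ _ ≡ suc n
    through-common = trans (pairCount≡ x∈ y∈ x≢y) ∘ cong suc

  block-size-R : ∀ s e → countᵇ (λ x → inR∞ A r x ∧ not (extend (meet s) e x))
                                (map just (filterᵇ (A r) (allFin v))) ≡ sizeR∖S s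
  block-size-R s e = trans (countᵇ-map _ just (filterᵇ (A r) (allFin v)))
                    (trans (countᵇ-filterᵇ _ (A r) (allFin v))
                           (countᵇ-cong (λ z → ∧-absorbs (A r z) (A s z)) (allFin v)))

  block-size : ∀ {s} → s ≢ r → countᵇ (block s) R∞ ≡ suc (suc l)
  block-size {s} s≢r with A r s in Ars
  ... | true  = trans (block-size-R s true) (sizeR∖S-adj Ars)
  ... | false = cong suc (trans (block-size-R s false) (sizeR∖S-nonadj s≢r Ars))

  nonadjacent-pair-in-R : ∃ λ x₀ → ∃ λ x₁ →
    A r x₀ ≡ true × A r x₁ ≡ true × A x₀ x₁ ≡ false × x₀ ≢ x₁
  nonadjacent-pair-in-R
    with x₀ , _ , Arx₀ ← countᵇ-pos⇒∃ (A r) (allFin v) (subst (0 <_) (sym (trans (regular r) k≡)) (s≤s z≤n))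
    with x₁ , _ , x₁∈R∖N[x₀] , x₁≢x₀ ← countᵇ>1⇒∃≢ _≟ᶠ_ (λ z → A r z ∧ not (A x₀ z)) (Unique.allFin⁺ v)
           (subst (1 <_) (sym (sizeR∖S-adj Arx₀)) (s≤s (s≤s z≤n))) x₀
    = x₀ , x₁ , Arx₀ , ∧-conicalˡ _ _ x₁∈R∖N[x₀] , not-injective (∧-conicalʳ _ _ x₁∈R∖N[x₀]) , x₁≢x₀ ∘ sym

  -- ∞ and a vertex of R lie in λ+1 blocks, two non-adjacent vertices of R in λ+2.
  not-a-design : ¬ (∃ λ c → ∀ x y → x ∈ R∞ → y ∈ R∞ → x ≢ y → pairCount (blocksB∞̄ A l r) x y ≡ c)
  not-a-design (c , constant) with x₀ , x₁ , Arx₀ , Arx₁ , Ax₀x₁ , x₀≢x₁ ← nonadjacent-pair-in-R =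
    1+n≢n (begin
      suc (suc l)                                  ≡⟨ cong suc (common-nonadj x₀ x₁ x₀≢x₁ Ax₀x₁) ⟨
      suc (common A x₀ x₁)                         ≡⟨ pairCount≡ x₀∈ x₁∈ (x₀≢x₁ ∘ just-injective) ⟨
      pairCount (blocksB∞̄ A l r) (just x₀) (just x₁) ≡⟨ constant _ _ x₀∈ x₁∈ (x₀≢x₁ ∘ just-injective) ⟩
      c                                            ≡⟨ constant _ _ (here refl) x₀∈ (λ ()) ⟨
      pairCount (blocksB∞̄ A l r) nothing (just x₀) ≡⟨ pairCount≡ (here refl) x₀∈ (λ ()) ⟩
      suc (common A r x₀)                          ≡⟨ cong suc (common-adj r x₀ (adjacent⇒≢ A-irrefl Arx₀) Arx₀) ⟩
      suc l                                        ∎)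
    where
    open ≡-Reasoning
    x₀∈ : just x₀ ∈ R∞
    x₀∈ = inR∞⇒∈R∞ {just x₀} Arx₀
    x₁∈ : just x₁ ∈ R∞
    x₁∈ = inR∞⇒∈R∞ {just x₁} Arx₁

  isAdesign : IsAdesign R∞ (blocksB∞̄ A l r) (suc k) (suc (suc l)) (suc l)
  isAdesign = R∞-unique
            , R∞-length
            , All.map⁺ (universal (λ B x Bx → inR∞⇒∈R∞ (∧-conicalˡ _ _ Bx)) (blocksB∞ A l r))
            , subst (All (λ B → countᵇ B R∞ ≡ suc (suc l))) (sym blocksB∞̄≡)
                    (All.map⁺ (All.tabulate (block-size ∘ ∈otherRows⇒≢)))
            , s≤s z≤n
            , pairCount-values
            , not-a-design

corollary3 : (v k l : ℕ) (A : Fin v → Fin v → Bool) (r : Fin v) →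
    IsSRG v k l (suc l) A → IsPaleyType v k l (suc l) →
    IsAdesign (pointsR∞ A r) (blocksB∞̄ A l r) (suc k) (suc (suc l)) (suc l)
corollary3 v k l A r (A-sym , A-irrefl , regular , common-adj , common-nonadj) paley
  with k≡ , v≡ ← isPaleyType⇒ paley =
  DerivedAdesign.isAdesign A r A-sym A-irrefl regular common-adj common-nonadj k≡ v≡
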